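{- For every $\bar d\ge1$ there is $n_0$ such that for all $n\ge n_0$ and every degree sequence $\mathcal{D}$ on a set $V$ of size $n$ with $\Sigma^{\mathcal{D}}\le\bar dn$, the probability that $G^{\mathcal{D}}[S_3]$ is a clique is at least $1-n^{ -1/11}$, where $S_3=\{u\in V:d(u)\ge n^{4/5}\}$.
   Context: A degree sequence on $V$ assigns positive integer degrees $d(u)$ and is realised by some simple graph; $\Sigma^{\mathcal{D}}=\sum_u d(u)$. $G^{\mathcal{D}}$ is a uniformly random simple graph on $V$ with degree sequence $\mathcal{D}$. -}

module Defs where

open import Data.Nat using (ℕ; zero; suc; _+_; _*_; _^_; _≤ᵇ_; _≡ᵇ_)
open import Data.Bool using (Bool; true; false; _∧_; not; if_then_else_)
open import Data.List using (List; []; _∷_; [_]; concatMap; map; allFin)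
open import Data.Bool.ListAction using (and)
open import Data.Nat.ListAction using (sum)
open import Data.Vec using (Vec; lookup; toList) renaming ([] to []ᵥ; _∷_ to _∷ᵥ_)
open import Data.Fin using (Fin; _≟_)
open import Relation.Nullary.Decidable using (⌊_⌋)
open import Relation.Unary using (Pred)

allVecs : {A : Set} → List A → (n : ℕ) → List (Vec A n)
allVecs xs zero = [ []ᵥ ]
allVecs xs (suc n) = concatMap (λ v → map (λ x → x ∷ᵥ v) xs) (allVecs xs n)

Matrix : ℕ → Set
Matrix n = Vec (Vec Bool n) n

adj : {n : ℕ} → Matrix n → Fin n → Fin n → Bool
adj M i j = lookup (lookup M i) j

allMatrices : (n : ℕ) → List (Matrix n)
allMatrices n = allVecs (allVecs (true ∷ false ∷ []) n) n

forallFin : (n : ℕ) → (Fin n → Bool) → Bool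
forallFin n p = and (map p (allFin n))

_==ᵇ_ : Bool → Bool → Bool
true ==ᵇ b = b
false ==ᵇ b = not b

isSimpleᵇ : {n : ℕ} → Matrix n → Bool
isSimpleᵇ {n} M =
  forallFin n (λ i → not (adj M i i) ∧ forallFin n (λ j → adj M i j ==ᵇ adj M j i))

degree : {n : ℕ} → Matrix n → Fin n → ℕ
degree M u = sum (map (λ b → if b then 1 else 0) (toList (lookup M u)))

DegSeq : ℕ → Set
DegSeq n = Fin n → ℕ

ΣD : {n : ℕ} → DegSeq n → ℕ
ΣD {n} D = sum (map D (allFin n))

hasDegSeqᵇ : {n : ℕ} → DegSeq n → Matrix n → Bool
hasDegSeqᵇ {n} D M = isSimpleᵇ M ∧ forallFin n (λ u → degree M u ≡ᵇ D u)

-- u ∈ S₃  iff  d(u) ≥ n^{4/5}  iff  n^4 ≤ d(u)^5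
inS₃ᵇ : {n : ℕ} → DegSeq n → Fin n → Bool
inS₃ᵇ {n} D u = (n ^ 4) ≤ᵇ (D u ^ 5)

S₃Cliqueᵇ : {n : ℕ} → DegSeq n → Matrix n → Bool
S₃Cliqueᵇ {n} D M =
  forallFin n (λ u → forallFin n (λ v →
    if ⌊ u ≟ v ⌋ then true
    else (if inS₃ᵇ D u ∧ inS₃ᵇ D v then adj M u v else true)))

countᵇ : {A : Set} → (A → Bool) → List A → ℕ
countᵇ p [] = 0
countᵇ p (x ∷ xs) = (if p x then 1 else 0) + countᵇ p xs

numGraphs : {n : ℕ} → DegSeq n → ℕ
numGraphs {n} D = countᵇ (hasDegSeqᵇ D) (allMatrices n)

numBad : {n : ℕ} → DegSeq n → ℕ
numBad {n} D = countᵇ (λ M → hasDegSeqᵇ D M ∧ not (S₃Cliqueᵇ D M)) (allMatrices n)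

module Submission where

-- Switching argument. Let B(u, v) count the realisations of D in which u ≠ v are not adjacent, and N
-- all realisations. In such a realisation, every pair a ~ u, b ~ v with a ≠ b and ab a non-edge can be
-- switched (ua, vb out; uv, ab in) to a realisation containing the edge ab, and the switch is invertible
-- given (u, v, a, b). At least d(u) d(v) − n − Σ pairs are switchable, while the images are counted by
-- N Σ, so B(u, v) (d(u) d(v) − n − Σ) ≤ N Σ. With δ the least degree in S₃ we have δ⁵ ≥ n⁴, hence
-- d(u) d(v) ≥ δ² ≥ 2 (n + Σ) once n ≥ (2 d̄)²⁸, and B(u, v) δ² ≤ 2 N Σ. Summing over the at most
-- (Σ / δ)² pairs of S₃ gives a failure probability of at most 2 Σ³ / δ⁴ ≤ 2 d̄³ n^(−1/5) ≤ n^(−1/11).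

open import Defs
open import Data.Nat using (ℕ; zero; suc; _+_; _*_; _^_; _≤_; _≤?_; z≤n; s≤s; NonZero; >-nonZero)
open import Data.Nat.Properties
  using ( +-assoc; +-comm; +-identityʳ; +-mono-≤; +-monoˡ-≤; +-monoʳ-≤; +-cancelʳ-≤
        ; *-assoc; *-comm; *-identityˡ; *-identityʳ; *-zeroʳ; *-distribˡ-+; *-mono-≤; *-monoˡ-≤; *-monoʳ-≤; *-cancelˡ-≤
        ; ^-*-assoc; ^-distribˡ-+-*; ^-monoˡ-≤; ^-monoʳ-≤; ^-monoˡ-<; m^n>0; m^n≢0
        ; m≤m+n; m≤n+m; m≤m*n; m≤n*m; ≤-refl; ≤-reflexive; ≤-trans; <⇒≱; ≰⇒>
        ; ≡ᵇ⇒≡; ≡⇒≡ᵇ; ≤ᵇ⇒≤; ≤-totalOrder; module ≤-Reasoning )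
open import Data.Nat.ListAction using (sum)
open import Data.Nat.Tactic.RingSolver using (solve-∀)
open import Data.Nat.Solver using (module +-*-Solver)
open +-*-Solver using (solve; _:+_; _:*_; _:^_; _:=_; con)
open import Data.Bool using (Bool; true; false; not; _∧_; _∨_; _xor_; if_then_else_)
open import Data.Bool.Properties
  using (∧-comm; ∧-zeroʳ; ∨-comm; ∨-identityʳ; xor-assoc; xor-same; not-¬; not-injective; T-≡)
  renaming (_≟_ to _≟ᴮ_)
open import Data.Bool.ListAction using (and)
open import Data.List using (List; []; _∷_; _++_; map; concatMap; allFin; length; filter)
open import Data.List.Properties using (length-tabulate; map-tabulate)
open import Data.List.Membership.Propositional using (_∈_)
open import Data.List.Membership.Propositional.Properties using (∈-allFin; ∈-filter⁺; ∈-map⁺)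
open import Data.List.Relation.Unary.Any using (here; there)
import Data.List.Relation.Unary.All as All
import Data.List.Relation.Unary.All.Properties as All
open import Data.List.Relation.Unary.All.Properties using (all-filter)
open import Data.List.Extrema ≤-totalOrder using (min; min≤xs; argmin-all)
open import Data.Fin using (Fin; zero; suc; _≟_)
open import Data.Fin.Properties using (suc-injective)
open import Data.Vec as Vec using (Vec; lookup; tabulate; toList)
open import Data.Vec.Properties using (lookup∘tabulate; tabulate∘lookup; tabulate-cong; ≡-dec)
open import Data.Product using (Σ; ∃-syntax; _×_; _,_; proj₁; proj₂)
open import Data.Sum using (_⊎_; inj₁; inj₂)
open import Function using (_∘_)
open import Function.Bundles using (Equivalence)
open import Relation.Nullary using (¬_; Dec; does; yes; no; contradiction)
open import Relation.Nullary.Decidable using (⌊_⌋; dec-true; dec-false)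
open import Relation.Binary.Definitions using (DecidableEquality)
open import Relation.Binary.PropositionalEquality
  using (_≡_; _≢_; refl; sym; trans; cong; cong₂; subst; module ≡-Reasoning)

𝟙 : Bool → ℕ
𝟙 b = if b then 1 else 0

∑ : {A : Set} → List A → (A → ℕ) → ℕ
∑ [] f = 0
∑ (x ∷ xs) f = f x + ∑ xs f

syntax ∑ L (λ x → e) = ∑[ x ∈ L ] e

-- Finite sums

module _ {A : Set} where

  ∑-cong : ∀ (L : List A) {f g : A → ℕ} → (∀ x → f x ≡ g x) → ∑ L f ≡ ∑ L g
  ∑-cong [] _ = refl
  ∑-cong (x ∷ L) f≗g = cong₂ _+_ (f≗g x) (∑-cong L f≗g)

  ∑-mono-≤-∈ : ∀ (L : List A) {f g : A → ℕ} → (∀ {x} → x ∈ L → f x ≤ g x) → ∑ L f ≤ ∑ L g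
  ∑-mono-≤-∈ [] _ = z≤n
  ∑-mono-≤-∈ (x ∷ L) f≤g = +-mono-≤ (f≤g (here refl)) (∑-mono-≤-∈ L (f≤g ∘ there))

  ∑-mono-≤ : ∀ (L : List A) {f g : A → ℕ} → (∀ x → f x ≤ g x) → ∑ L f ≤ ∑ L g
  ∑-mono-≤ L f≤g = ∑-mono-≤-∈ L (λ {x} _ → f≤g x)

  ∑-zero : ∀ (L : List A) → ∑[ _ ∈ L ] 0 ≡ 0
  ∑-zero [] = refl
  ∑-zero (_ ∷ L) = ∑-zero L

  ∑-const : ∀ (L : List A) c → ∑[ _ ∈ L ] c ≡ length L * c
  ∑-const [] c = refl
  ∑-const (_ ∷ L) c = cong (c +_) (∑-const L c)

  ∑-distrib-+ : ∀ (L : List A) (f g : A → ℕ) → ∑[ x ∈ L ] (f x + g x) ≡ ∑ L f + ∑ L g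
  ∑-distrib-+ [] f g = refl
  ∑-distrib-+ (x ∷ L) f g = trans (cong (f x + g x +_) (∑-distrib-+ L f g)) (interchange (f x) (g x) _ _)
    where
    interchange : ∀ a b c d → a + b + (c + d) ≡ a + c + (b + d)
    interchange = solve-∀

  *-distribˡ-∑ : ∀ c (L : List A) (f : A → ℕ) → c * ∑ L f ≡ ∑[ x ∈ L ] (c * f x)
  *-distribˡ-∑ c [] f = *-zeroʳ c
  *-distribˡ-∑ c (x ∷ L) f = trans (*-distribˡ-+ c (f x) (∑ L f)) (cong (c * f x +_) (*-distribˡ-∑ c L f))

  *-distribʳ-∑ : ∀ c (L : List A) (f : A → ℕ) → ∑ L f * c ≡ ∑[ x ∈ L ] (f x * c)
  *-distribʳ-∑ c L f = trans (*-comm (∑ L f) c) (trans (*-distribˡ-∑ c L f) (∑-cong L (λ x → *-comm c (f x))))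

  ∑-++ : ∀ (L M : List A) (f : A → ℕ) → ∑ (L ++ M) f ≡ ∑ L f + ∑ M f
  ∑-++ [] M f = refl
  ∑-++ (x ∷ L) M f = trans (cong (f x +_) (∑-++ L M f)) (sym (+-assoc (f x) _ _))

  ∈⇒≤∑ : ∀ {L : List A} (f : A → ℕ) {x} → x ∈ L → f x ≤ ∑ L f
  ∈⇒≤∑ {y ∷ L} f (here refl) = m≤m+n (f y) (∑ L f)
  ∈⇒≤∑ {y ∷ L} f (there x∈L) = ≤-trans (∈⇒≤∑ f x∈L) (m≤n+m (∑ L f) (f y))

  ∑-filter-≤ : ∀ {P : A → Set} (P? : ∀ x → Dec (P x)) (L : List A) (f : A → ℕ) → ∑ (filter P? L) f ≤ ∑ L f
  ∑-filter-≤ P? [] f = z≤n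
  ∑-filter-≤ P? (x ∷ L) f with P? x
  ... | yes _ = +-monoʳ-≤ (f x) (∑-filter-≤ P? L f)
  ... | no _ = ≤-trans (∑-filter-≤ P? L f) (m≤n+m (∑ L f) (f x))

  sum∘map≡∑ : ∀ (f : A → ℕ) (L : List A) → sum (map f L) ≡ ∑ L f
  sum∘map≡∑ f [] = refl
  sum∘map≡∑ f (x ∷ L) = cong (f x +_) (sum∘map≡∑ f L)

  countᵇ≡∑ : ∀ (p : A → Bool) (L : List A) → countᵇ p L ≡ ∑[ x ∈ L ] 𝟙 (p x)
  countᵇ≡∑ p [] = refl
  countᵇ≡∑ p (x ∷ L) = cong (𝟙 (p x) +_) (countᵇ≡∑ p L)

module _ {A B : Set} where

  ∑-map : ∀ (g : A → B) (L : List A) (f : B → ℕ) → ∑ (map g L) f ≡ ∑[ x ∈ L ] f (g x)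
  ∑-map g [] f = refl
  ∑-map g (x ∷ L) f = cong (f (g x) +_) (∑-map g L f)

  ∑-concatMap : ∀ (g : A → List B) (L : List A) (f : B → ℕ) → ∑ (concatMap g L) f ≡ ∑[ x ∈ L ] ∑ (g x) f
  ∑-concatMap g [] f = refl
  ∑-concatMap g (x ∷ L) f = trans (∑-++ (g x) (concatMap g L) f) (cong (∑ (g x) f +_) (∑-concatMap g L f))

  ∑-comm : ∀ (L : List A) (M : List B) (f : A → B → ℕ) →
    ∑[ x ∈ L ] ∑[ y ∈ M ] f x y ≡ ∑[ y ∈ M ] ∑[ x ∈ L ] f x y
  ∑-comm [] M f = sym (∑-zero M)
  ∑-comm (x ∷ L) M f = trans (cong (∑ M (f x) +_) (∑-comm L M f)) (sym (∑-distrib-+ M (f x) _))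

  ∑∑-distrib-+ : ∀ (L : List A) (M : List B) (f g : A → B → ℕ) →
    ∑[ x ∈ L ] ∑[ y ∈ M ] (f x y + g x y) ≡ ∑[ x ∈ L ] ∑[ y ∈ M ] f x y + ∑[ x ∈ L ] ∑[ y ∈ M ] g x y
  ∑∑-distrib-+ L M f g = trans (∑-cong L λ x → ∑-distrib-+ M (f x) (g x)) (∑-distrib-+ L _ _)

module _ {A B C : Set} where

  ∑-comm-∑∑ : ∀ (K : List C) (L : List A) (M : List B) (f : C → A → B → ℕ) →
    ∑[ z ∈ K ] ∑[ x ∈ L ] ∑[ y ∈ M ] f z x y ≡ ∑[ x ∈ L ] ∑[ y ∈ M ] ∑[ z ∈ K ] f z x y
  ∑-comm-∑∑ K L M f = trans (∑-comm K L _) (∑-cong L λ x → ∑-comm K M (λ z → f z x))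

∑-allFin-suc : ∀ {n} (f : Fin (suc n) → ℕ) → ∑ (allFin (suc n)) f ≡ f zero + ∑[ i ∈ allFin n ] f (suc i)
∑-allFin-suc {n} f =
  cong (f zero +_) (trans (cong (λ L → ∑ L f) (sym (map-tabulate (λ i → i) suc))) (∑-map suc (allFin n) f))

∑-toList : ∀ {n} {C : Set} (f : C → ℕ) (v : Vec C n) → ∑ (toList v) f ≡ ∑[ j ∈ allFin n ] f (lookup v j)
∑-toList f Vec.[] = refl
∑-toList f (x Vec.∷ v) = trans (cong (f x +_) (∑-toList f v)) (sym (∑-allFin-suc (λ j → f (lookup (x Vec.∷ v) j))))

-- Sums differing only at index y, stated without truncated subtraction.
∑-allFin-update : ∀ {n} (f g : Fin n → ℕ) (y : Fin n) → (∀ j → j ≢ y → f j ≡ g j) →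
  ∑ (allFin n) f + g y ≡ ∑ (allFin n) g + f y
∑-allFin-update {suc n} f g zero f≗g
  rewrite ∑-allFin-suc f | ∑-allFin-suc g | ∑-cong (allFin n) (λ i → f≗g (suc i) λ ())
  = a+s+b≡b+s+a (f zero) (g zero) _
  where
  a+s+b≡b+s+a : ∀ a b s → a + s + b ≡ b + s + a
  a+s+b≡b+s+a = solve-∀
∑-allFin-update {suc n} f g (suc y) f≗g rewrite ∑-allFin-suc f | ∑-allFin-suc g | f≗g zero (λ ()) =
  trans (+-assoc (g zero) _ _) (trans (cong (g zero +_) ih) (sym (+-assoc (g zero) _ _)))
  where
  ih = ∑-allFin-update (f ∘ suc) (g ∘ suc) y (λ j j≢y → f≗g (suc j) (j≢y ∘ suc-injective))

-- Enumerations

module Enumeration {A : Set} (_≟ᴬ_ : DecidableEquality A) where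

  δ : A → A → ℕ
  δ x y = 𝟙 (does (x ≟ᴬ y))

  record Enumerates (L : List A) : Set where
    constructor enumerates
    field
      multiplicity≡1 : ∀ z → ∑[ y ∈ L ] δ y z ≡ 1
  open Enumerates public

  δ-subst : ∀ (f : A → ℕ) y z → δ y z * f y ≡ δ y z * f z
  δ-subst f y z with y ≟ᴬ z
  ... | yes refl = refl
  ... | no _ = refl

  ∑-δ : ∀ {L} → Enumerates L → ∀ (f : A → ℕ) z → ∑[ y ∈ L ] (δ y z * f y) ≡ f z
  ∑-δ {L} enum f z = begin
    ∑[ y ∈ L ] (δ y z * f y) ≡⟨ ∑-cong L (λ y → δ-subst f y z) ⟩
    ∑[ y ∈ L ] (δ y z * f z) ≡⟨ *-distribʳ-∑ (f z) L (λ y → δ y z) ⟨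
    ∑[ y ∈ L ] δ y z * f z   ≡⟨ cong (_* f z) (multiplicity≡1 enum z) ⟩
    1 * f z                  ≡⟨ *-identityˡ (f z) ⟩
    f z                      ∎
    where open ≡-Reasoning

  ∑-reindex : ∀ {L} → Enumerates L → (Φ Ψ : A → A) → (∀ x → Ψ (Φ x) ≡ x) → (∀ y → Φ (Ψ y) ≡ y) →
    ∀ (f : A → ℕ) → ∑[ x ∈ L ] f (Φ x) ≡ ∑ L f
  ∑-reindex {L} enum Φ Ψ ΨΦ ΦΨ f = begin
    ∑[ x ∈ L ] f (Φ x)
      ≡⟨ ∑-cong L (λ x → ∑-δ enum f (Φ x)) ⟨
    ∑[ x ∈ L ] ∑[ y ∈ L ] (δ y (Φ x) * f y)
      ≡⟨ ∑-cong L (λ x → ∑-cong L (λ y → cong (_* f y) (δ-transpose x y))) ⟩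
    ∑[ x ∈ L ] ∑[ y ∈ L ] (δ x (Ψ y) * f y)
      ≡⟨ ∑-comm L L _ ⟩
    ∑[ y ∈ L ] ∑[ x ∈ L ] (δ x (Ψ y) * f y)
      ≡⟨ ∑-cong L (λ y → *-distribʳ-∑ (f y) L (λ x → δ x (Ψ y))) ⟨
    ∑[ y ∈ L ] (∑[ x ∈ L ] δ x (Ψ y) * f y)
      ≡⟨ ∑-cong L (λ y → trans (cong (_* f y) (multiplicity≡1 enum (Ψ y))) (*-identityˡ (f y))) ⟩
    ∑ L f ∎
    where
    open ≡-Reasoning
    δ-transpose : ∀ x y → δ y (Φ x) ≡ δ x (Ψ y)
    δ-transpose x y with y ≟ᴬ Φ x | x ≟ᴬ Ψ y
    ... | yes _ | yes _ = refl
    ... | no _ | no _ = refl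
    ... | yes y≡Φx | no x≢Ψy = contradiction (trans (sym (ΨΦ x)) (cong Ψ (sym y≡Φx))) x≢Ψy
    ... | no y≢Φx | yes x≡Ψy = contradiction (trans (sym (ΦΨ y)) (cong Φ (sym x≡Ψy))) y≢Φx

open Enumeration using (Enumerates; enumerates; multiplicity≡1; ∑-reindex)

allFin-enumerates : ∀ n → Enumerates (_≟_ {n}) (allFin n)
allFin-enumerates n = enumerates (count n)
  where
  count : ∀ n (z : Fin n) → ∑[ i ∈ allFin n ] 𝟙 (does (i ≟ z)) ≡ 1
  count (suc n) zero =
    trans (∑-allFin-suc {n} (λ i → 𝟙 (does (i ≟ zero)))) (cong suc (∑-zero (allFin n)))
  count (suc n) (suc j) =
    trans (∑-allFin-suc {n} (λ i → 𝟙 (does (i ≟ suc j)))) (trans (∑-cong (allFin n) δ-suc) (count n j))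
    where
    δ-suc : ∀ i → 𝟙 (does (suc i ≟ suc j)) ≡ 𝟙 (does (i ≟ j))
    δ-suc i with i ≟ j
    ... | yes _ = refl
    ... | no _ = refl

allVecs-enumerates : ∀ {A : Set} (_≟ᴬ_ : DecidableEquality A) {xs} → Enumerates _≟ᴬ_ xs →
  ∀ n → Enumerates (≡-dec {n = n} _≟ᴬ_) (allVecs xs n)
allVecs-enumerates {A} _≟ᴬ_ {xs} enum n = enumerates (count n)
  where
  open Enumeration using (δ)
  count : ∀ n (z : Vec A n) → ∑[ y ∈ allVecs xs n ] δ (≡-dec _≟ᴬ_) y z ≡ 1
  count zero Vec.[] = refl
  count (suc n) (x Vec.∷ w) = begin
    ∑[ y ∈ allVecs xs (suc n) ] δ⁺ y (x Vec.∷ w)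
      ≡⟨ ∑-concatMap _ (allVecs xs n) _ ⟩
    ∑[ v ∈ allVecs xs n ] ∑[ y ∈ map (Vec._∷ v) xs ] δ⁺ y (x Vec.∷ w)
      ≡⟨ ∑-cong (allVecs xs n) (λ v → ∑-map (Vec._∷ v) xs _) ⟩
    ∑[ v ∈ allVecs xs n ] ∑[ y ∈ xs ] δ⁺ (y Vec.∷ v) (x Vec.∷ w)
      ≡⟨ ∑-cong (allVecs xs n) (λ v → ∑-cong xs (λ y → δ-∷ y v)) ⟩
    ∑[ v ∈ allVecs xs n ] ∑[ y ∈ xs ] (δⁿ v w * δᴬ y x)
      ≡⟨ ∑-cong (allVecs xs n) (λ v → sym (*-distribˡ-∑ (δⁿ v w) xs (λ y → δᴬ y x))) ⟩
    ∑[ v ∈ allVecs xs n ] (δⁿ v w * ∑[ y ∈ xs ] δᴬ y x)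
      ≡⟨ ∑-cong (allVecs xs n) (λ v → trans (cong (δⁿ v w *_) (multiplicity≡1 enum x)) (*-identityʳ _)) ⟩
    ∑[ v ∈ allVecs xs n ] δⁿ v w
      ≡⟨ count n w ⟩
    1 ∎
    where
    open ≡-Reasoning
    δᴬ = δ _≟ᴬ_
    δⁿ = δ (≡-dec {n = n} _≟ᴬ_)
    δ⁺ = δ (≡-dec {n = suc n} _≟ᴬ_)
    δ-∷ : ∀ y v → δ⁺ (y Vec.∷ v) (x Vec.∷ w) ≡ δⁿ v w * δᴬ y x
    δ-∷ y v with ≡-dec {n = n} _≟ᴬ_ v w | y ≟ᴬ x
    ... | yes _ | yes _ = refl
    ... | yes _ | no _ = refl
    ... | no _ | yes _ = refl
    ... | no _ | no _ = refl

_≟ᴹ_ : ∀ {n} → DecidableEquality (Matrix n)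
_≟ᴹ_ = ≡-dec (≡-dec _≟ᴮ_)

allMatrices-enumerates : ∀ n → Enumerates (_≟ᴹ_ {n}) (allMatrices n)
allMatrices-enumerates n =
  allVecs-enumerates (≡-dec _≟ᴮ_) (allVecs-enumerates _≟ᴮ_ allBools n) n
  where
  allBools : Enumerates _≟ᴮ_ (true ∷ false ∷ [])
  allBools = enumerates λ { true → refl ; false → refl }

-- Simple graphs with a given degree sequence

∧-≡-true⁻ : ∀ {a b} → a ∧ b ≡ true → a ≡ true × b ≡ true
∧-≡-true⁻ {true} {true} _ = refl , refl

∧-≡-true⁺ : ∀ {a b} → a ≡ true → b ≡ true → a ∧ b ≡ true
∧-≡-true⁺ refl refl = refl

==ᵇ-≡-true⁻ : ∀ {a b} → (a ==ᵇ b) ≡ true → a ≡ b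
==ᵇ-≡-true⁻ {true} {true} _ = refl
==ᵇ-≡-true⁻ {false} {false} _ = refl

==ᵇ-refl : ∀ a → (a ==ᵇ a) ≡ true
==ᵇ-refl true = refl
==ᵇ-refl false = refl

module _ {A : Set} (p : A → Bool) where

  and-map-≡-true⁻ : ∀ {L} → and (map p L) ≡ true → ∀ {x} → x ∈ L → p x ≡ true
  and-map-≡-true⁻ {y ∷ L} allTrue (here refl) = proj₁ (∧-≡-true⁻ allTrue)
  and-map-≡-true⁻ {y ∷ L} allTrue (there x∈L) = and-map-≡-true⁻ (proj₂ (∧-≡-true⁻ {p y} allTrue)) x∈L

  and-map-≡-true⁺ : ∀ L → (∀ x → p x ≡ true) → and (map p L) ≡ true
  and-map-≡-true⁺ [] _ = refl
  and-map-≡-true⁺ (x ∷ L) allTrue = ∧-≡-true⁺ (allTrue x) (and-map-≡-true⁺ L allTrue)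

  and-map-≡-false⁻ : ∀ L → and (map p L) ≡ false → ∃[ x ] p x ≡ false
  and-map-≡-false⁻ (x ∷ L) none with p x in px
  ... | false = x , px
  ... | true = and-map-≡-false⁻ L none

module _ {n : ℕ} (p : Fin n → Bool) where

  forallFin-≡-true⁻ : forallFin n p ≡ true → ∀ i → p i ≡ true
  forallFin-≡-true⁻ allTrue i = and-map-≡-true⁻ p allTrue (∈-allFin i)

  forallFin-≡-true⁺ : (∀ i → p i ≡ true) → forallFin n p ≡ true
  forallFin-≡-true⁺ = and-map-≡-true⁺ p (allFin n)

  forallFin-≡-false⁻ : forallFin n p ≡ false → ∃[ i ] p i ≡ false
  forallFin-≡-false⁻ = and-map-≡-false⁻ p (allFin n)

module _ {n : ℕ} where

  deg : Matrix n → Fin n → ℕ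
  deg M u = ∑[ j ∈ allFin n ] 𝟙 (adj M u j)

  degree≡deg : ∀ M u → degree M u ≡ deg M u
  degree≡deg M u = trans (sum∘map≡∑ 𝟙 (toList (lookup M u))) (∑-toList 𝟙 (lookup M u))

  record IsSimple (M : Matrix n) : Set where
    field
      irreflexive : ∀ i → adj M i i ≡ false
      symmetric : ∀ i j → adj M i j ≡ adj M j i

  record HasDegSeq (D : DegSeq n) (M : Matrix n) : Set where
    field
      simple : IsSimple M
      deg≡ : ∀ u → deg M u ≡ D u

  open IsSimple public
  open HasDegSeq public

  hasDegSeqᵇ-sound : ∀ {D M} → hasDegSeqᵇ D M ≡ true → HasDegSeq D M
  hasDegSeqᵇ-sound {D} {M} hasDeg = record
    { simple = record
      { irreflexive = λ i → not-injective (proj₁ (∧-≡-true⁻ (row i)))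
      ; symmetric = λ i j → ==ᵇ-≡-true⁻ (forallFin-≡-true⁻ _ (proj₂ (∧-≡-true⁻ {not (adj M i i)} (row i))) j)
      }
    ; deg≡ = λ u → trans (sym (degree≡deg M u)) (≡ᵇ⇒≡ _ _ (Equivalence.from T-≡ (forallFin-≡-true⁻ _ degrees u)))
    }
    where
    simpleᵇ = proj₁ (∧-≡-true⁻ hasDeg)
    degrees = proj₂ (∧-≡-true⁻ {isSimpleᵇ M} hasDeg)
    row = forallFin-≡-true⁻ _ simpleᵇ

  hasDegSeqᵇ-complete : ∀ {D M} → HasDegSeq D M → hasDegSeqᵇ D M ≡ true
  hasDegSeqᵇ-complete {D} {M} hasDeg = ∧-≡-true⁺
    (forallFin-≡-true⁺ _ λ i → ∧-≡-true⁺ (cong not (irreflexive (simple hasDeg) i))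
      (forallFin-≡-true⁺ _ λ j →
        subst (λ b → (adj M i j ==ᵇ b) ≡ true) (symmetric (simple hasDeg) i j) (==ᵇ-refl (adj M i j))))
    (forallFin-≡-true⁺ _ λ u → Equivalence.to T-≡ (≡⇒≡ᵇ _ _ (trans (degree≡deg M u) (deg≡ hasDeg u))))


  ΣD≡∑ : (D : DegSeq n) → ΣD D ≡ ∑ (allFin n) D
  ΣD≡∑ D = sum∘map≡∑ D (allFin n)

  handshake : ∀ {D M} → HasDegSeq D M → ∑[ a ∈ allFin n ] ∑[ b ∈ allFin n ] 𝟙 (adj M a b) ≡ ΣD D
  handshake {D} hasDeg = trans (∑-cong (allFin n) (deg≡ hasDeg)) (sym (ΣD≡∑ D))

  deg*deg≡∑∑ : ∀ M u v → deg M u * deg M v ≡ ∑[ a ∈ allFin n ] ∑[ b ∈ allFin n ] (𝟙 (adj M u a) * 𝟙 (adj M v b))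
  deg*deg≡∑∑ M u v = trans (*-distribʳ-∑ (deg M v) (allFin n) _)
    (∑-cong (allFin n) λ a → *-distribˡ-∑ (𝟙 (adj M u a)) (allFin n) _)

  ∑∑-diagonal : ∑[ a ∈ allFin n ] ∑[ b ∈ allFin n ] 𝟙 (does (a ≟ b)) ≡ n
  ∑∑-diagonal = begin
    ∑[ a ∈ allFin n ] ∑[ b ∈ allFin n ] 𝟙 (does (a ≟ b)) ≡⟨ ∑-comm (allFin n) (allFin n) _ ⟩
    ∑[ b ∈ allFin n ] ∑[ a ∈ allFin n ] 𝟙 (does (a ≟ b)) ≡⟨ ∑-cong (allFin n) (multiplicity≡1 (allFin-enumerates n)) ⟩
    ∑[ b ∈ allFin n ] 1                                   ≡⟨ ∑-const (allFin n) 1 ⟩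
    length (allFin n) * 1                                 ≡⟨ *-identityʳ _ ⟩
    length (allFin n)                                     ≡⟨ length-tabulate (λ i → i) ⟩
    n                                                     ∎
    where open ≡-Reasoning

  onPair : Fin n → Fin n → Fin n → Fin n → Bool
  onPair x y i j = (does (i ≟ x) ∧ does (j ≟ y)) ∨ (does (i ≟ y) ∧ does (j ≟ x))

  toggle : Fin n → Fin n → Matrix n → Matrix n
  toggle x y M = tabulate λ i → tabulate λ j → onPair x y i j xor adj M i j

  adj-toggle : ∀ x y M i j → adj (toggle x y M) i j ≡ onPair x y i j xor adj M i j
  adj-toggle x y M i j = trans (cong (λ r → lookup r j) (lookup∘tabulate _ i)) (lookup∘tabulate _ j)

  matrix-ext : ∀ {M N : Matrix n} → (∀ i j → adj M i j ≡ adj N i j) → M ≡ N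
  matrix-ext {M} {N} M≗N = begin
    M                   ≡⟨ tabulate∘lookup M ⟨
    tabulate (lookup M) ≡⟨ tabulate-cong (λ i → trans (sym (tabulate∘lookup (lookup M i)))
                             (trans (tabulate-cong (M≗N i)) (tabulate∘lookup (lookup N i)))) ⟩
    tabulate (lookup N) ≡⟨ tabulate∘lookup N ⟩
    N                   ∎
    where open ≡-Reasoning

  toggle-involutive : ∀ x y M → toggle x y (toggle x y M) ≡ M
  toggle-involutive x y M = matrix-ext {toggle x y (toggle x y M)} {M} entry
    where
    open ≡-Reasoning
    entry : ∀ i j → adj (toggle x y (toggle x y M)) i j ≡ adj M i j
    entry i j = begin
      adj (toggle x y (toggle x y M)) i j ≡⟨ adj-toggle x y (toggle x y M) i j ⟩
      p xor adj (toggle x y M) i j        ≡⟨ cong (p xor_) (adj-toggle x y M i j) ⟩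
      p xor (p xor adj M i j)             ≡⟨ xor-assoc p p _ ⟨
      (p xor p) xor adj M i j             ≡⟨ cong (_xor adj M i j) (xor-same p) ⟩
      adj M i j                           ∎
      where p = onPair x y i j

  onPair-comm : ∀ x y i j → onPair x y i j ≡ onPair y x i j
  onPair-comm x y i j = ∨-comm (does (i ≟ x) ∧ does (j ≟ y)) (does (i ≟ y) ∧ does (j ≟ x))

  onPair-transpose : ∀ x y i j → onPair x y i j ≡ onPair x y j i
  onPair-transpose x y i j rewrite ∧-comm (does (i ≟ x)) (does (j ≟ y)) | ∧-comm (does (i ≟ y)) (does (j ≟ x)) =
    ∨-comm (does (j ≟ y) ∧ does (i ≟ x)) (does (j ≟ x) ∧ does (i ≟ y))

  toggle-comm : ∀ x y M → toggle x y M ≡ toggle y x M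
  toggle-comm x y M = matrix-ext {toggle x y M} {toggle y x M} λ i j →
    trans (adj-toggle x y M i j) (trans (cong (_xor adj M i j) (onPair-comm x y i j)) (sym (adj-toggle y x M i j)))

  onPair-false : ∀ {x y i j} → (i ≢ x ⊎ j ≢ y) → (i ≢ y ⊎ j ≢ x) → onPair x y i j ≡ false
  onPair-false i≢x⊎j≢y i≢y⊎j≢x = cong₂ _∨_ (both-false i≢x⊎j≢y) (both-false i≢y⊎j≢x)
    where
    both-false : ∀ {a b c d : Fin n} → (a ≢ b ⊎ c ≢ d) → does (a ≟ b) ∧ does (c ≟ d) ≡ false
    both-false {a} {b} (inj₁ a≢b) rewrite dec-false (a ≟ b) a≢b = refl
    both-false {c = c} {d} (inj₂ c≢d) rewrite dec-false (c ≟ d) c≢d = ∧-zeroʳ _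

  onPair-row : ∀ {x y} → x ≢ y → ∀ j → onPair x y x j ≡ does (j ≟ y)
  onPair-row {x} {y} x≢y j rewrite dec-true (x ≟ x) refl | dec-false (x ≟ y) x≢y = ∨-identityʳ _

  module Toggle {x y : Fin n} (x≢y : x ≢ y) (M : Matrix n) where

    private
      M′ = toggle x y M

    adj-toggle-pair : adj M′ x y ≡ not (adj M x y)
    adj-toggle-pair rewrite adj-toggle x y M x y | onPair-row x≢y y | dec-true (y ≟ y) refl = refl

    adj-toggle-other : ∀ {i j} → (i ≢ x ⊎ j ≢ y) → (i ≢ y ⊎ j ≢ x) → adj M′ i j ≡ adj M i j
    adj-toggle-other {i} {j} i≢x⊎j≢y i≢y⊎j≢x
      rewrite adj-toggle x y M i j | onPair-false i≢x⊎j≢y i≢y⊎j≢x = refl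

    toggle-simple : IsSimple M → IsSimple M′
    toggle-simple simpleM = record
      { irreflexive = λ i → trans (off-diagonal i) (irreflexive simpleM i)
      ; symmetric = λ i j → trans (adj-toggle x y M i j)
          (trans (cong₂ _xor_ (onPair-transpose x y i j) (symmetric simpleM i j)) (sym (adj-toggle x y M j i)))
      }
      where
      off-diagonal : ∀ i → adj M′ i i ≡ adj M i i
      off-diagonal i with i ≟ x
      ... | yes refl = adj-toggle-other (inj₂ x≢y) (inj₁ x≢y)
      ... | no i≢x = adj-toggle-other (inj₁ i≢x) (inj₂ i≢x)

    deg-toggle-other : ∀ {i} → i ≢ x → i ≢ y → deg M′ i ≡ deg M i
    deg-toggle-other i≢x i≢y = ∑-cong (allFin n) λ j → cong 𝟙 (adj-toggle-other (inj₁ i≢x) (inj₁ i≢y))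

    deg-toggle-endpoint : deg M′ x + 𝟙 (adj M x y) ≡ deg M x + 𝟙 (not (adj M x y))
    deg-toggle-endpoint =
      trans (∑-allFin-update (λ j → 𝟙 (adj M′ x j)) (λ j → 𝟙 (adj M x j)) y
              λ j j≢y → cong 𝟙 (adj-toggle-other (inj₂ j≢y) (inj₁ x≢y)))
            (cong (λ b → deg M x + 𝟙 b) adj-toggle-pair)

    deg-toggle-edge : adj M x y ≡ true → deg M′ x + 1 ≡ deg M x
    deg-toggle-edge = removed deg-toggle-endpoint
      where
      removed : ∀ {d′ d c} → d′ + 𝟙 c ≡ d + 𝟙 (not c) → c ≡ true → d′ + 1 ≡ d
      removed {d = d} eq refl = trans eq (+-identityʳ d)

    deg-toggle-nonedge : adj M x y ≡ false → deg M′ x ≡ deg M x + 1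
    deg-toggle-nonedge = added deg-toggle-endpoint
      where
      added : ∀ {d′ d c} → d′ + 𝟙 c ≡ d + 𝟙 (not c) → c ≡ false → d′ ≡ d + 1
      added {d′} eq refl = trans (sym (+-identityʳ d′)) eq

  open Toggle public

  deg-toggle-edgeʳ : ∀ {x y} (x≢y : x ≢ y) {M} → IsSimple M → adj M x y ≡ true →
    deg (toggle x y M) y + 1 ≡ deg M y
  deg-toggle-edgeʳ {x} {y} x≢y {M} simpleM xy = subst (λ N → deg N y + 1 ≡ deg M y) (sym (toggle-comm x y M))
    (deg-toggle-edge (x≢y ∘ sym) M (trans (symmetric simpleM y x) xy))

  deg-toggle-nonedgeʳ : ∀ {x y} (x≢y : x ≢ y) {M} → IsSimple M → adj M x y ≡ false →
    deg (toggle x y M) y ≡ deg M y + 1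
  deg-toggle-nonedgeʳ {x} {y} x≢y {M} simpleM xy = subst (λ N → deg N y ≡ deg M y + 1) (sym (toggle-comm x y M))
    (deg-toggle-nonedge (x≢y ∘ sym) M (trans (symmetric simpleM y x) xy))

-- Switchings

module _ {n : ℕ} where

  -- Removes the edges ua, vb and adds uv, ab.
  switch : (u v a b : Fin n) → Matrix n → Matrix n
  switch u v a b = toggle a b ∘ toggle u v ∘ toggle v b ∘ toggle u a

  unswitch : (u v a b : Fin n) → Matrix n → Matrix n
  unswitch u v a b = toggle u a ∘ toggle v b ∘ toggle u v ∘ toggle a b

  unswitch∘switch : ∀ u v a b M → unswitch u v a b (switch u v a b M) ≡ M
  unswitch∘switch u v a b M
    rewrite toggle-involutive a b (toggle u v (toggle v b (toggle u a M)))
          | toggle-involutive u v (toggle v b (toggle u a M))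
          | toggle-involutive v b (toggle u a M) = toggle-involutive u a M

  switch∘unswitch : ∀ u v a b M → switch u v a b (unswitch u v a b M) ≡ M
  switch∘unswitch u v a b M
    rewrite toggle-involutive u a (toggle v b (toggle u v (toggle a b M)))
          | toggle-involutive v b (toggle u v (toggle a b M))
          | toggle-involutive u v (toggle a b M) = toggle-involutive a b M

  switchable : (u v a b : Fin n) → Matrix n → Bool
  switchable u v a b M = adj M u a ∧ adj M v b ∧ not (adj M a b) ∧ not (does (a ≟ b))

  module Switching {D : DegSeq n} {M : Matrix n} (hasDeg : HasDegSeq D M) {u v a b : Fin n}
    (u≢v : u ≢ v) (uv : adj M u v ≡ false) (ok : switchable u v a b M ≡ true) where

    private
      simple₀ = simple hasDeg
      ua : adj M u a ≡ true
      ua = proj₁ (∧-≡-true⁻ ok)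
      vb : adj M v b ≡ true
      vb = proj₁ (∧-≡-true⁻ (proj₂ (∧-≡-true⁻ {adj M u a} ok)))
      ab∧a≢b = proj₂ (∧-≡-true⁻ {adj M v b} (proj₂ (∧-≡-true⁻ {adj M u a} ok)))
      ab : adj M a b ≡ false
      ab = not-injective (proj₁ (∧-≡-true⁻ ab∧a≢b))
      a≢b : a ≢ b
      a≢b a≡b = not-¬ (dec-true (a ≟ b) a≡b) (not-injective (proj₂ (∧-≡-true⁻ {not (adj M a b)} ab∧a≢b)))

      loopless : ∀ {i j} → adj M i j ≡ true → i ≢ j
      loopless {i} ij refl = not-¬ ij (irreflexive simple₀ i)

      u≢a : u ≢ a
      u≢a = loopless ua
      v≢b : v ≢ b
      v≢b = loopless vb
      a≢v : a ≢ v
      a≢v refl = not-¬ ua uv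
      u≢b : u ≢ b
      u≢b refl = not-¬ (trans (symmetric simple₀ u v) vb) uv

      M₁ = toggle u a M
      M₂ = toggle v b M₁
      M₃ = toggle u v M₂
      M₄ = toggle a b M₃

      simple₁ = toggle-simple u≢a M simple₀
      simple₂ = toggle-simple v≢b M₁ simple₁
      simple₃ = toggle-simple u≢v M₂ simple₂

      vb₁ : adj M₁ v b ≡ true
      vb₁ = trans (adj-toggle-other u≢a M (inj₁ (u≢v ∘ sym)) (inj₁ (a≢v ∘ sym))) vb
      uv₂ : adj M₂ u v ≡ false
      uv₂ = trans (adj-toggle-other v≢b M₁ (inj₁ u≢v) (inj₁ u≢b))
            (trans (adj-toggle-other u≢a M (inj₂ (a≢v ∘ sym)) (inj₁ u≢a)) uv)
      ab₃ : adj M₃ a b ≡ false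
      ab₃ = trans (adj-toggle-other u≢v M₂ (inj₁ (u≢a ∘ sym)) (inj₁ a≢v))
            (trans (adj-toggle-other v≢b M₁ (inj₁ a≢v) (inj₁ a≢b))
            (trans (adj-toggle-other u≢a M (inj₁ (u≢a ∘ sym)) (inj₂ (u≢b ∘ sym))) ab))

    switch-simple : IsSimple (switch u v a b M)
    switch-simple = toggle-simple a≢b M₃ simple₃

    adj-switch-ab : adj (switch u v a b M) a b ≡ true
    adj-switch-ab = trans (adj-toggle-pair a≢b M₃) (cong not ab₃)

    open ≡-Reasoning

    deg-switch : ∀ i → deg (switch u v a b M) i ≡ deg M i
    deg-switch i with i ≟ u | i ≟ v | i ≟ a | i ≟ b
    ... | yes refl | _ | _ | _ = begin
      deg M₄ u     ≡⟨ deg-toggle-other a≢b M₃ u≢a u≢b ⟩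
      deg M₃ u     ≡⟨ deg-toggle-nonedge u≢v M₂ uv₂ ⟩
      deg M₂ u + 1 ≡⟨ cong (_+ 1) (deg-toggle-other v≢b M₁ u≢v u≢b) ⟩
      deg M₁ u + 1 ≡⟨ deg-toggle-edge u≢a M ua ⟩
      deg M u      ∎
    ... | no _ | yes refl | _ | _ = begin
      deg M₄ v     ≡⟨ deg-toggle-other a≢b M₃ (a≢v ∘ sym) v≢b ⟩
      deg M₃ v     ≡⟨ deg-toggle-nonedgeʳ u≢v simple₂ uv₂ ⟩
      deg M₂ v + 1 ≡⟨ deg-toggle-edge v≢b M₁ vb₁ ⟩
      deg M₁ v     ≡⟨ deg-toggle-other u≢a M (u≢v ∘ sym) (a≢v ∘ sym) ⟩
      deg M v      ∎
    ... | no _ | no _ | yes refl | _ = begin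
      deg M₄ a     ≡⟨ deg-toggle-nonedge a≢b M₃ ab₃ ⟩
      deg M₃ a + 1 ≡⟨ cong (_+ 1) (deg-toggle-other u≢v M₂ (u≢a ∘ sym) a≢v) ⟩
      deg M₂ a + 1 ≡⟨ cong (_+ 1) (deg-toggle-other v≢b M₁ a≢v a≢b) ⟩
      deg M₁ a + 1 ≡⟨ deg-toggle-edgeʳ u≢a simple₀ ua ⟩
      deg M a      ∎
    ... | no _ | no _ | no _ | yes refl = begin
      deg M₄ b     ≡⟨ deg-toggle-nonedgeʳ a≢b simple₃ ab₃ ⟩
      deg M₃ b + 1 ≡⟨ cong (_+ 1) (deg-toggle-other u≢v M₂ (u≢b ∘ sym) (v≢b ∘ sym)) ⟩
      deg M₂ b + 1 ≡⟨ deg-toggle-edgeʳ v≢b simple₁ vb₁ ⟩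
      deg M₁ b     ≡⟨ deg-toggle-other u≢a M (u≢b ∘ sym) (a≢b ∘ sym) ⟩
      deg M b      ∎
    ... | no i≢u | no i≢v | no i≢a | no i≢b =
      trans (deg-toggle-other a≢b M₃ i≢a i≢b) (trans (deg-toggle-other u≢v M₂ i≢u i≢v)
      (trans (deg-toggle-other v≢b M₁ i≢v i≢b) (deg-toggle-other u≢a M i≢u i≢a)))

    switch-hasDegSeq : HasDegSeq D (switch u v a b M)
    switch-hasDegSeq = record { simple = switch-simple ; deg≡ = λ i → trans (deg-switch i) (deg≡ hasDeg i) }

-- Counting switchings

module _ {n : ℕ} (D : DegSeq n) where

  missingEdge : Fin n → Fin n → Matrix n → Bool
  missingEdge u v M = hasDegSeqᵇ D M ∧ not (adj M u v)

  numMissing : Fin n → Fin n → ℕ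
  numMissing u v = countᵇ (missingEdge u v) (allMatrices n)

module MissingEdge {n : ℕ} (D : DegSeq n) {u v : Fin n} (u≢v : u ≢ v) where

  private
    V = allFin n
    Ms = allMatrices n
    Σᴰ = ΣD D
    missing = missingEdge D u v

  switchings : Matrix n → ℕ
  switchings M = ∑[ a ∈ V ] ∑[ b ∈ V ] 𝟙 (switchable u v a b M)

  -- A pair (a, b) with a ~ u and b ~ v fails to be switchable only if a = b or ab is an edge.
  switchings-lower : ∀ {M} → HasDegSeq D M → adj M u v ≡ false → D u * D v ≤ switchings M + (n + Σᴰ)
  switchings-lower {M} hasDeg uv = begin
    D u * D v
      ≡⟨ cong₂ _*_ (deg≡ hasDeg u) (deg≡ hasDeg v) ⟨
    deg M u * deg M v
      ≡⟨ deg*deg≡∑∑ M u v ⟩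
    ∑[ a ∈ V ] ∑[ b ∈ V ] (𝟙 (adj M u a) * 𝟙 (adj M v b))
      ≤⟨ ∑-mono-≤ V (λ a → ∑-mono-≤ V λ b → pointwise (adj M u a) (adj M v b) (adj M a b) (does (a ≟ b))) ⟩
    ∑[ a ∈ V ] ∑[ b ∈ V ] (𝟙 (switchable u v a b M) + (𝟙 (does (a ≟ b)) + 𝟙 (adj M a b)))
      ≡⟨ ∑∑-distrib-+ V V (λ a b → 𝟙 (switchable u v a b M)) (λ a b → 𝟙 (does (a ≟ b)) + 𝟙 (adj M a b)) ⟩
    switchings M + ∑[ a ∈ V ] ∑[ b ∈ V ] (𝟙 (does (a ≟ b)) + 𝟙 (adj M a b))
      ≡⟨ cong (switchings M +_) (∑∑-distrib-+ V V (λ a b → 𝟙 (does (a ≟ b))) (λ a b → 𝟙 (adj M a b))) ⟩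
    switchings M + (∑[ a ∈ V ] ∑[ b ∈ V ] 𝟙 (does (a ≟ b)) + ∑[ a ∈ V ] ∑[ b ∈ V ] 𝟙 (adj M a b))
      ≡⟨ cong (λ k → switchings M + k) (cong₂ _+_ ∑∑-diagonal (handshake hasDeg)) ⟩
    switchings M + (n + Σᴰ) ∎
    where
    open ≤-Reasoning
    pointwise : ∀ x y z e → 𝟙 x * 𝟙 y ≤ 𝟙 (x ∧ y ∧ not z ∧ not e) + (𝟙 e + 𝟙 z)
    pointwise true true false false = ≤-refl
    pointwise true true false true = ≤-refl
    pointwise true true true false = ≤-refl
    pointwise true true true true = s≤s z≤n
    pointwise true false z e = z≤n
    pointwise false y z e = z≤n

  missing-switch : ∀ M a b → 𝟙 (missing M) * 𝟙 (switchable u v a b M) ≤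
    𝟙 (hasDegSeqᵇ D (switch u v a b M) ∧ adj (switch u v a b M) a b)
  missing-switch M a b with missing M in missingM | switchable u v a b M in ok
  ... | false | _ = z≤n
  ... | true | false = z≤n
  ... | true | true = ≤-reflexive (sym (cong 𝟙 (∧-≡-true⁺ (hasDegSeqᵇ-complete switch-hasDegSeq) adj-switch-ab)))
    where
    open Switching {M = M} (hasDegSeqᵇ-sound (proj₁ (∧-≡-true⁻ missingM))) {a = a} {b} u≢v
      (not-injective (proj₂ (∧-≡-true⁻ {hasDegSeqᵇ D M} missingM))) ok

  ∑-realised-edges : ∑[ M ∈ Ms ] ∑[ a ∈ V ] ∑[ b ∈ V ] 𝟙 (hasDegSeqᵇ D M ∧ adj M a b) ≡ numGraphs D * Σᴰ
  ∑-realised-edges = begin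
    ∑[ M ∈ Ms ] ∑[ a ∈ V ] ∑[ b ∈ V ] 𝟙 (hasDegSeqᵇ D M ∧ adj M a b) ≡⟨ ∑-cong Ms edges ⟩
    ∑[ M ∈ Ms ] (𝟙 (hasDegSeqᵇ D M) * Σᴰ)                            ≡⟨ *-distribʳ-∑ Σᴰ Ms _ ⟨
    ∑[ M ∈ Ms ] 𝟙 (hasDegSeqᵇ D M) * Σᴰ                              ≡⟨ cong (_* Σᴰ) (countᵇ≡∑ _ Ms) ⟨
    numGraphs D * Σᴰ                                                ∎
    where
    open ≡-Reasoning
    edges : ∀ M → ∑[ a ∈ V ] ∑[ b ∈ V ] 𝟙 (hasDegSeqᵇ D M ∧ adj M a b) ≡ 𝟙 (hasDegSeqᵇ D M) * Σᴰ
    edges M with hasDegSeqᵇ D M in hasDeg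
    ... | false = trans (∑-cong V λ _ → ∑-zero V) (∑-zero V)
    ... | true = trans (handshake (hasDegSeqᵇ-sound {M = M} hasDeg)) (sym (+-identityʳ Σᴰ))

  -- Every switching lands injectively in a realisation together with one of its Σᴰ oriented edges.
  ∑-switchings : ∑[ M ∈ Ms ] (𝟙 (missing M) * switchings M) ≤ numGraphs D * Σᴰ
  ∑-switchings = begin
    ∑[ M ∈ Ms ] (𝟙 (missing M) * switchings M)
      ≡⟨ ∑-cong Ms (λ M → trans (*-distribˡ-∑ (𝟙 (missing M)) V _)
           (∑-cong V λ a → *-distribˡ-∑ (𝟙 (missing M)) V _)) ⟩
    ∑[ M ∈ Ms ] ∑[ a ∈ V ] ∑[ b ∈ V ] (𝟙 (missing M) * 𝟙 (switchable u v a b M))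
      ≡⟨ ∑-comm-∑∑ Ms V V _ ⟩
    ∑[ a ∈ V ] ∑[ b ∈ V ] ∑[ M ∈ Ms ] (𝟙 (missing M) * 𝟙 (switchable u v a b M))
      ≤⟨ ∑-mono-≤ V (λ a → ∑-mono-≤ V λ b → ∑-mono-≤ Ms λ M → missing-switch M a b) ⟩
    ∑[ a ∈ V ] ∑[ b ∈ V ] ∑[ M ∈ Ms ] 𝟙 (hasDegSeqᵇ D (switch u v a b M) ∧ adj (switch u v a b M) a b)
      ≡⟨ ∑-cong V (λ a → ∑-cong V λ b → ∑-reindex _≟ᴹ_ (allMatrices-enumerates n) (switch u v a b) (unswitch u v a b)
           (unswitch∘switch u v a b) (switch∘unswitch u v a b) λ M → 𝟙 (hasDegSeqᵇ D M ∧ adj M a b)) ⟩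
    ∑[ a ∈ V ] ∑[ b ∈ V ] ∑[ M ∈ Ms ] 𝟙 (hasDegSeqᵇ D M ∧ adj M a b)
      ≡⟨ ∑-comm-∑∑ Ms V V _ ⟨
    ∑[ M ∈ Ms ] ∑[ a ∈ V ] ∑[ b ∈ V ] 𝟙 (hasDegSeqᵇ D M ∧ adj M a b)
      ≡⟨ ∑-realised-edges ⟩
    numGraphs D * Σᴰ ∎
    where open ≤-Reasoning

  numMissing-bound : numMissing D u v * (D u * D v) ≤ numGraphs D * Σᴰ + numMissing D u v * (n + Σᴰ)
  numMissing-bound = begin
    numMissing D u v * (D u * D v)
      ≡⟨ trans (cong (_* (D u * D v)) (countᵇ≡∑ missing Ms)) (*-distribʳ-∑ _ Ms _) ⟩
    ∑[ M ∈ Ms ] (𝟙 (missing M) * (D u * D v))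
      ≤⟨ ∑-mono-≤ Ms pointwise ⟩
    ∑[ M ∈ Ms ] (𝟙 (missing M) * switchings M + 𝟙 (missing M) * (n + Σᴰ))
      ≡⟨ ∑-distrib-+ Ms _ _ ⟩
    ∑[ M ∈ Ms ] (𝟙 (missing M) * switchings M) + ∑[ M ∈ Ms ] (𝟙 (missing M) * (n + Σᴰ))
      ≤⟨ +-monoˡ-≤ _ ∑-switchings ⟩
    numGraphs D * Σᴰ + ∑[ M ∈ Ms ] (𝟙 (missing M) * (n + Σᴰ))
      ≡⟨ cong (numGraphs D * Σᴰ +_) (trans (cong (_* (n + Σᴰ)) (countᵇ≡∑ missing Ms)) (*-distribʳ-∑ _ Ms _)) ⟨
    numGraphs D * Σᴰ + numMissing D u v * (n + Σᴰ) ∎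
    where
    open ≤-Reasoning
    pointwise : ∀ M → 𝟙 (missing M) * (D u * D v) ≤ 𝟙 (missing M) * switchings M + 𝟙 (missing M) * (n + Σᴰ)
    pointwise M with missing M in missingM
    ... | false = z≤n
    ... | true = begin
      1 * (D u * D v)                              ≡⟨ *-identityˡ _ ⟩
      D u * D v                                    ≤⟨ switchings-lower (hasDegSeqᵇ-sound {M = M} (proj₁ (∧-≡-true⁻ missingM)))
                                                        (not-injective (proj₂ (∧-≡-true⁻ {hasDegSeqᵇ D M} missingM))) ⟩
      switchings M + (n + Σᴰ)                      ≡⟨ cong₂ _+_ (*-identityˡ (switchings M)) (*-identityˡ (n + Σᴰ)) ⟨
      1 * switchings M + 1 * (n + Σᴰ)              ∎

-- High-degree vertices

x≤y+z∧2z≤x⇒x≤2y : ∀ {x y z} → x ≤ y + z → 2 * z ≤ x → x ≤ 2 * y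
x≤y+z∧2z≤x⇒x≤2y {x} {y} {z} x≤y+z 2z≤x = +-cancelʳ-≤ x x (2 * y) (begin
  x + x             ≤⟨ +-mono-≤ x≤y+z x≤y+z ⟩
  (y + z) + (y + z) ≡⟨ rearrange y z ⟩
  2 * z + 2 * y     ≤⟨ +-monoˡ-≤ (2 * y) 2z≤x ⟩
  x + 2 * y         ≡⟨ +-comm x (2 * y) ⟩
  2 * y + x         ∎)
  where
  open ≤-Reasoning
  rearrange : ∀ y z → (y + z) + (y + z) ≡ 2 * z + 2 * y
  rearrange = solve-∀

x*[y*z]≡y*[x*z] : ∀ x y z → x * (y * z) ≡ y * (x * z)
x*[y*z]≡y*[x*z] = solve-∀

clique-entry-false⁻ : ∀ {P : Set} (d : Dec P) {s t e : Bool} →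
  (if ⌊ d ⌋ then true else (if s ∧ t then e else true)) ≡ false → ¬ P × s ≡ true × t ≡ true × e ≡ false
clique-entry-false⁻ (no ¬p) {true} {true} {false} _ = ¬p , refl , refl , refl
clique-entry-false⁻ (yes _) ()
clique-entry-false⁻ (no _) {false} ()
clique-entry-false⁻ (no _) {true} {false} ()
clique-entry-false⁻ (no _) {true} {true} {true} ()

module HighDegree {n : ℕ} (D : DegSeq n) where

  S₃ : List (Fin n)
  S₃ = filter (λ u → n ^ 4 ≤? D u ^ 5) (allFin n)

  inS₃ᵇ-sound : ∀ {u} → inS₃ᵇ D u ≡ true → u ∈ S₃
  inS₃ᵇ-sound {u} inS₃ = ∈-filter⁺ (λ u → n ^ 4 ≤? D u ^ 5) (∈-allFin u)
    (≤ᵇ⇒≤ (n ^ 4) (D u ^ 5) (Equivalence.from T-≡ inS₃))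

  S₃Cliqueᵇ-false⁻ : ∀ {M} → S₃Cliqueᵇ D M ≡ false →
    ∃[ u ] ∃[ v ] u ≢ v × u ∈ S₃ × v ∈ S₃ × adj M u v ≡ false
  S₃Cliqueᵇ-false⁻ {M} notClique =
    let u , rowᵤ = forallFin-≡-false⁻ _ notClique
        v , entry = forallFin-≡-false⁻ _ rowᵤ
        u≢v , u∈S₃ , v∈S₃ , uv = clique-entry-false⁻ (u ≟ v) {inS₃ᵇ D u} {inS₃ᵇ D v} {adj M u v} entry
    in u , v , u≢v , inS₃ᵇ-sound u∈S₃ , inS₃ᵇ-sound v∈S₃ , uv

  private
    Ms = allMatrices n

  offDiagonal : Fin n → Fin n → ℕ
  offDiagonal u v = 𝟙 (not (does (u ≟ v)))

  union-bound : numBad D ≤ ∑[ u ∈ S₃ ] ∑[ v ∈ S₃ ] (offDiagonal u v * numMissing D u v)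
  union-bound = begin
    numBad D
      ≡⟨ countᵇ≡∑ _ Ms ⟩
    ∑[ M ∈ Ms ] 𝟙 (hasDegSeqᵇ D M ∧ not (S₃Cliqueᵇ D M))
      ≤⟨ ∑-mono-≤ Ms some-pair ⟩
    ∑[ M ∈ Ms ] ∑[ u ∈ S₃ ] ∑[ v ∈ S₃ ] (offDiagonal u v * 𝟙 (missingEdge D u v M))
      ≡⟨ ∑-comm-∑∑ Ms S₃ S₃ _ ⟩
    ∑[ u ∈ S₃ ] ∑[ v ∈ S₃ ] ∑[ M ∈ Ms ] (offDiagonal u v * 𝟙 (missingEdge D u v M))
      ≡⟨ ∑-cong S₃ (λ u → ∑-cong S₃ λ v → trans (sym (*-distribˡ-∑ (offDiagonal u v) Ms _))
           (cong (offDiagonal u v *_) (sym (countᵇ≡∑ (missingEdge D u v) Ms)))) ⟩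
    ∑[ u ∈ S₃ ] ∑[ v ∈ S₃ ] (offDiagonal u v * numMissing D u v) ∎
    where
    open ≤-Reasoning
    some-pair : ∀ M → 𝟙 (hasDegSeqᵇ D M ∧ not (S₃Cliqueᵇ D M)) ≤
      ∑[ u ∈ S₃ ] ∑[ v ∈ S₃ ] (offDiagonal u v * 𝟙 (missingEdge D u v M))
    some-pair M with hasDegSeqᵇ D M ∧ not (S₃Cliqueᵇ D M) in bad
    ... | false = z≤n
    ... | true with ∧-≡-true⁻ {hasDegSeqᵇ D M} bad
    ... | hasDeg , notClique with S₃Cliqueᵇ-false⁻ {M} (not-injective notClique)
    ... | u , v , u≢v , u∈S₃ , v∈S₃ , uv =
      ≤-trans (≤-reflexive (sym witness))
        (≤-trans (∈⇒≤∑ (λ v → offDiagonal u v * 𝟙 (missingEdge D u v M)) v∈S₃) (∈⇒≤∑ _ u∈S₃))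
      where
      witness : offDiagonal u v * 𝟙 (missingEdge D u v M) ≡ 1
      witness rewrite dec-false (u ≟ v) u≢v | hasDeg | uv = refl

  -- On an empty S₃ this is n, which still satisfies n⁴ ≤ δ⁵.
  δ : ℕ
  δ = min n (map D S₃)

  δ≤D : ∀ {u} → u ∈ S₃ → δ ≤ D u
  δ≤D u∈S₃ = All.lookup (min≤xs n (map D S₃)) (∈-map⁺ D u∈S₃)

  n⁴≤δ⁵ : n ^ 4 ≤ δ ^ 5
  n⁴≤δ⁵ = argmin-all (λ d → d) {P = λ d → n ^ 4 ≤ d ^ 5} (m⁴≤m⁵ n)
    (All.map⁺ (all-filter (λ u → n ^ 4 ≤? D u ^ 5) (allFin n)))
    where
    m⁴≤m⁵ : ∀ m → m ^ 4 ≤ m ^ 5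
    m⁴≤m⁵ zero = z≤n
    m⁴≤m⁵ (suc m) = m≤n*m (suc m ^ 4) (suc m)

  |S₃|*δ≤ΣD : length S₃ * δ ≤ ΣD D
  |S₃|*δ≤ΣD = begin
    length S₃ * δ      ≡⟨ ∑-const S₃ δ ⟨
    ∑[ _ ∈ S₃ ] δ      ≤⟨ ∑-mono-≤-∈ S₃ δ≤D ⟩
    ∑ S₃ D             ≤⟨ ∑-filter-≤ (λ u → n ^ 4 ≤? D u ^ 5) (allFin n) D ⟩
    ∑ (allFin n) D     ≡⟨ ΣD≡∑ D ⟨
    ΣD D               ∎
    where open ≤-Reasoning

  module _ (2[n+ΣD]≤δ² : 2 * (n + ΣD D) ≤ δ * δ) where

    pair-bound : ∀ {u v} → u ∈ S₃ → v ∈ S₃ → offDiagonal u v * numMissing D u v * (δ * δ) ≤ 2 * (numGraphs D * ΣD D)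
    pair-bound {u} {v} u∈S₃ v∈S₃ with u ≟ v
    ... | yes _ = z≤n
    ... | no u≢v = begin
      1 * B * (δ * δ)  ≡⟨ cong (_* (δ * δ)) (*-identityˡ B) ⟩
      B * (δ * δ)      ≤⟨ *-monoʳ-≤ B δ²≤DuDv ⟩
      B * (D u * D v)  ≤⟨ x≤y+z∧2z≤x⇒x≤2y {z = B * (n + ΣD D)} (numMissing-bound u≢v) 2z≤x ⟩
      2 * (numGraphs D * ΣD D) ∎
      where
      open ≤-Reasoning
      open MissingEdge D
      B = numMissing D u v
      δ²≤DuDv = *-mono-≤ (δ≤D u∈S₃) (δ≤D v∈S₃)
      2z≤x : 2 * (B * (n + ΣD D)) ≤ B * (D u * D v)
      2z≤x = begin
        2 * (B * (n + ΣD D)) ≡⟨ x*[y*z]≡y*[x*z] 2 B (n + ΣD D) ⟩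
        B * (2 * (n + ΣD D)) ≤⟨ *-monoʳ-≤ B (≤-trans 2[n+ΣD]≤δ² δ²≤DuDv) ⟩
        B * (D u * D v)      ∎

    numBad-bound : numBad D * (δ * δ) ≤ length S₃ * length S₃ * (2 * (numGraphs D * ΣD D))
    numBad-bound = begin
      numBad D * (δ * δ)
        ≤⟨ *-monoˡ-≤ (δ * δ) union-bound ⟩
      ∑[ u ∈ S₃ ] ∑[ v ∈ S₃ ] (offDiagonal u v * numMissing D u v) * (δ * δ)
        ≡⟨ trans (*-distribʳ-∑ (δ * δ) S₃ _) (∑-cong S₃ λ u → *-distribʳ-∑ (δ * δ) S₃ _) ⟩
      ∑[ u ∈ S₃ ] ∑[ v ∈ S₃ ] (offDiagonal u v * numMissing D u v * (δ * δ))
        ≤⟨ ∑-mono-≤-∈ S₃ (λ u∈S₃ → ∑-mono-≤-∈ S₃ λ v∈S₃ → pair-bound u∈S₃ v∈S₃) ⟩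
      ∑[ u ∈ S₃ ] ∑[ v ∈ S₃ ] C
        ≡⟨ trans (∑-cong S₃ λ _ → ∑-const S₃ C) (∑-const S₃ (length S₃ * C)) ⟩
      length S₃ * (length S₃ * C)
        ≡⟨ *-assoc (length S₃) (length S₃) C ⟨
      length S₃ * length S₃ * C ∎
      where
      open ≤-Reasoning
      C = 2 * (numGraphs D * ΣD D)

-- Asymptotics

m^k≤n^k⇒m≤n : ∀ k .{{_ : NonZero k}} {m n} → m ^ k ≤ n ^ k → m ≤ n
m^k≤n^k⇒m≤n k {m} {n} mᵏ≤nᵏ with m ≤? n
... | yes m≤n = m≤n
... | no m≰n = contradiction mᵏ≤nᵏ (<⇒≱ (^-monoˡ-< k (≰⇒> m≰n)))

module Asymptotics (c n : ℕ) (c≥1 : 1 ≤ c) (n-large : (2 * c) ^ 28 ≤ n) where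

  private
    R = 2 * c
    Q = 2 * c ^ 3
    2≤R : 2 ≤ R
    2≤R = *-monoʳ-≤ 2 c≥1
    instance
      c-nonZero : NonZero c
      c-nonZero = >-nonZero c≥1
      R-nonZero : NonZero R
      R-nonZero = >-nonZero (≤-trans (s≤s z≤n) 2≤R)
      n-nonZero : NonZero n
      n-nonZero = >-nonZero (≤-trans (m^n>0 R 28) n-large)

  2[n+S]≤δ² : ∀ {S δ} → S ≤ c * n → n ^ 4 ≤ δ ^ 5 → 2 * (n + S) ≤ δ * δ
  2[n+S]≤δ² {S} {δ} S≤cn n⁴≤δ⁵ = m^k≤n^k⇒m≤n 5 (begin
    (2 * (n + S)) ^ 5         ≤⟨ ^-monoˡ-≤ 5 (*-monoʳ-≤ 2 (+-monoʳ-≤ n S≤cn)) ⟩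
    (2 * (n + c * n)) ^ 5     ≤⟨ ^-monoˡ-≤ 5 (*-monoʳ-≤ 2 (+-monoˡ-≤ (c * n) (m≤n*m n c))) ⟩
    (2 * (c * n + c * n)) ^ 5 ≡⟨ solve 2 (λ x y → (con 2 :* (x :* y :+ x :* y)) :^ 5 := con 32 :* (con 2 :* x) :^ 5 :* y :^ 5) refl c n ⟩
    32 * R ^ 5 * n ^ 5        ≤⟨ *-monoˡ-≤ (n ^ 5) (*-monoˡ-≤ (R ^ 5) (^-monoˡ-≤ 5 2≤R)) ⟩
    R ^ 5 * R ^ 5 * n ^ 5     ≡⟨ cong (_* n ^ 5) (^-distribˡ-+-* R 5 5) ⟨
    R ^ 10 * n ^ 5            ≤⟨ *-monoˡ-≤ (n ^ 5) R¹⁰≤n³ ⟩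
    n ^ 3 * n ^ 5             ≡⟨ solve 1 (λ x → x :^ 3 :* x :^ 5 := (x :^ 4) :^ 2) refl n ⟩
    (n ^ 4) ^ 2               ≤⟨ ^-monoˡ-≤ 2 n⁴≤δ⁵ ⟩
    (δ ^ 5) ^ 2               ≡⟨ solve 1 (λ x → (x :^ 5) :^ 2 := (x :* x) :^ 5) refl δ ⟩
    (δ * δ) ^ 5               ∎)
    where
    open ≤-Reasoning
    R¹⁰≤n³ : R ^ 10 ≤ n ^ 3
    R¹⁰≤n³ = ≤-trans (^-monoʳ-≤ R (m≤m+n 10 18)) (≤-trans n-large (m≤m*n n (n ^ 2) {{m^n≢0 n 2}}))

  module _ (A N S K δ : ℕ) (S≤cn : S ≤ c * n) (Kδ≤S : K * δ ≤ S) (n⁴≤δ⁵ : n ^ 4 ≤ δ ^ 5)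
    (Aδ²≤K²2NS : A * (δ * δ) ≤ K * K * (2 * (N * S))) where

    private
      Aδ⁴≤n³QN : A * (δ * δ) * (δ * δ) ≤ n ^ 3 * (Q * N)
      Aδ⁴≤n³QN = begin
        A * (δ * δ) * (δ * δ)               ≤⟨ *-monoˡ-≤ (δ * δ) Aδ²≤K²2NS ⟩
        K * K * (2 * (N * S)) * (δ * δ)     ≡⟨ solve 4 (λ K δ N S → K :* K :* (con 2 :* (N :* S)) :* (δ :* δ)
                                                 := (K :* δ) :* (K :* δ) :* (con 2 :* (N :* S))) refl K δ N S ⟩
        (K * δ) * (K * δ) * (2 * (N * S))   ≤⟨ *-mono-≤ (*-mono-≤ Kδ≤cn Kδ≤cn) (*-monoʳ-≤ 2 (*-monoʳ-≤ N S≤cn)) ⟩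
        (c * n) * (c * n) * (2 * (N * (c * n))) ≡⟨ solve 3 (λ c n N → (c :* n) :* (c :* n) :* (con 2 :* (N :* (c :* n)))
                                                     := n :^ 3 :* (con 2 :* c :^ 3 :* N)) refl c n N ⟩
        n ^ 3 * (Q * N)                     ∎
        where
        open ≤-Reasoning
        Kδ≤cn = ≤-trans Kδ≤S S≤cn

      A⁵n≤Q⁵N⁵ : A ^ 5 * n ≤ Q ^ 5 * N ^ 5
      A⁵n≤Q⁵N⁵ = *-cancelˡ-≤ (n ^ 15) {{m^n≢0 n 15}} (begin
        n ^ 15 * (A ^ 5 * n)          ≡⟨ solve 2 (λ n A → n :^ 15 :* (A :^ 5 :* n) := A :^ 5 :* (n :^ 4) :^ 4) refl n A ⟩
        A ^ 5 * (n ^ 4) ^ 4           ≤⟨ *-monoʳ-≤ (A ^ 5) (^-monoˡ-≤ 4 n⁴≤δ⁵) ⟩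
        A ^ 5 * (δ ^ 5) ^ 4           ≡⟨ solve 2 (λ A δ → A :^ 5 :* (δ :^ 5) :^ 4 := (A :* (δ :* δ) :* (δ :* δ)) :^ 5) refl A δ ⟩
        (A * (δ * δ) * (δ * δ)) ^ 5   ≤⟨ ^-monoˡ-≤ 5 Aδ⁴≤n³QN ⟩
        (n ^ 3 * (Q * N)) ^ 5         ≡⟨ solve 3 (λ n Q N → (n :^ 3 :* (Q :* N)) :^ 5 := n :^ 15 :* (Q :^ 5 :* N :^ 5)) refl n Q N ⟩
        n ^ 15 * (Q ^ 5 * N ^ 5)      ∎)
        where open ≤-Reasoning

      Q⁵⁵≤n⁶ : Q ^ 55 ≤ n ^ 6
      Q⁵⁵≤n⁶ = begin
        Q ^ 55         ≤⟨ ^-monoˡ-≤ 55 Q≤R³ ⟩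
        (R ^ 3) ^ 55   ≡⟨ ^-*-assoc R 3 55 ⟩
        R ^ 165        ≤⟨ ^-monoʳ-≤ R (m≤m+n 165 3) ⟩
        R ^ (28 * 6)   ≡⟨ ^-*-assoc R 28 6 ⟨
        (R ^ 28) ^ 6   ≤⟨ ^-monoˡ-≤ 6 n-large ⟩
        n ^ 6          ∎
        where
        open ≤-Reasoning
        Q≤R³ : Q ≤ R ^ 3
        Q≤R³ = ≤-trans (m≤m+n Q (6 * c ^ 3))
          (≤-reflexive (solve 1 (λ c → con 2 :* c :^ 3 :+ con 6 :* c :^ 3 := (con 2 :* c) :^ 3) refl c))

    n*A¹¹≤N¹¹ : n * A ^ 11 ≤ N ^ 11
    n*A¹¹≤N¹¹ = m^k≤n^k⇒m≤n 5 (*-cancelˡ-≤ (n ^ 6) {{m^n≢0 n 6}} (begin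
      n ^ 6 * (n * A ^ 11) ^ 5   ≡⟨ solve 2 (λ n A → n :^ 6 :* (n :* A :^ 11) :^ 5 := (A :^ 5 :* n) :^ 11) refl n A ⟩
      (A ^ 5 * n) ^ 11           ≤⟨ ^-monoˡ-≤ 11 A⁵n≤Q⁵N⁵ ⟩
      (Q ^ 5 * N ^ 5) ^ 11       ≡⟨ solve 2 (λ Q N → (Q :^ 5 :* N :^ 5) :^ 11 := Q :^ 55 :* (N :^ 11) :^ 5) refl Q N ⟩
      Q ^ 55 * (N ^ 11) ^ 5      ≤⟨ *-monoˡ-≤ ((N ^ 11) ^ 5) Q⁵⁵≤n⁶ ⟩
      n ^ 6 * (N ^ 11) ^ 5       ∎))
      where open ≤-Reasoning

lemma9p1 : (d̄ : ℕ) → 1 ≤ d̄ →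
    ∃[ n₀ ] ((n : ℕ) → n₀ ≤ n → (D : DegSeq n) →
      ((u : Fin n) → 1 ≤ D u) →
      Σ (Matrix n) (λ M → hasDegSeqᵇ D M ≡ true) →
      ΣD D ≤ d̄ * n →
      n * numBad D ^ 11 ≤ numGraphs D ^ 11)
lemma9p1 d̄ d̄≥1 = (2 * d̄) ^ 28 , λ n n-large D _ _ ΣD≤d̄n →
  let open HighDegree D
      open Asymptotics d̄ n d̄≥1 n-large
  in n*A¹¹≤N¹¹ (numBad D) (numGraphs D) (ΣD D) (length S₃) δ
       ΣD≤d̄n |S₃|*δ≤ΣD n⁴≤δ⁵ (numBad-bound (2[n+S]≤δ² {δ = δ} ΣD≤d̄n n⁴≤δ⁵))
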